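{- Let $\theta \in \mathcal{L}$. Then $\theta$ is satisfiable in a multi-agent epistemic model if and only if there exists a multi-agent epistemic Hintikka structure for $\theta$.
   Context: Fix a nonempty set $\mathbf{AP}$ of atomic propositions and a finite set $\Sigma$ of agents with at least two elements. The language $\mathcal{L}$ is given by $\varphi ::= p \mid \neg\varphi \mid \varphi_1 \wedge \varphi_2 \mid K_a\varphi \mid D\varphi \mid C\varphi$, with $p \in \mathbf{AP}$, $a \in \Sigma$. A multi-agent epistemic structure (MAES) is a tuple $(\Sigma, S, \{R_a\}_{a\in\Sigma}, R_D, R_C)$ with $S\neq\emptyset$, $R_a, R_D$ binary relations on $S$, and $R_C$ the transitive closure of $R_D \cup \bigcup_{a} R_a$. A multi-agent epistemic model (MAEM) is such a structure in which every $R_a$ and $R_D$ is an equivalence relation and $R_D = \bigcap_{a \in \Sigma} R_a$, together with a labeling $L : S \to \mathcal{P}(\mathbf{AP})$. Satisfaction is standard: $p$ holds at $s$ iff $p\in L(s)$, Booleans as usual, $\mathcal{M},s\models K_a\varphi$ iff $\varphi$ holds at all $t$ with $(s,t)\in R_a$, and similarly $D$ with $R_D$ and $C$ with $R_C$. $\theta$ is satisfiable in a MAEM if $\mathcal{M},s\models\theta$ for some MAEM $\mathcal{M}$ and state $s$. A set $\Delta \subseteq \mathcal{L}$ is fully expanded if: $\neg\neg\varphi\in\Delta$ implies $\varphi\in\Delta$; $\varphi\wedge\psi\in\Delta$ implies $\varphi,\psi\in\Delta$; $\neg(\varphi\wedge\psi)\in\Delta$ implies $\neg\varphi\in\Delta$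 or $\neg\psi\in\Delta$; $K_a\varphi\in\Delta$ implies $D\varphi\in\Delta$; $D\varphi\in\Delta$ implies $\varphi\in\Delta$; $C\varphi\in\Delta$ implies $K_a(\varphi\wedge C\varphi)\in\Delta$ for every $a\in\Sigma$; $\neg C\varphi\in\Delta$ implies $\neg K_a(\varphi\wedge C\varphi)\in\Delta$ for some $a\in\Sigma$; and if $\varphi\in\Delta$ and $\psi$ is a subformula of $\varphi$ of the form $K_a\chi$ or $D\chi$, then $\psi\in\Delta$ or $\neg\psi\in\Delta$. A multi-agent epistemic Hintikka structure (MAEHS) is a tuple $(\Sigma, S, \{R_a\}, R_D, R_C, H)$ where $(\Sigma,S,\{R_a\},R_D,R_C)$ is a MAES and $H$ assigns to each $s\in S$ a set $H(s)\subseteq\mathcal{L}$ such that: (H1) if $\neg\varphi\in H(s)$ then $\varphi\notin H(s)$; (H2) each $H(s)$ is fully expanded; (H3) if $K_a\varphi\in H(s)$ and $(s,t)\in R_a$ then $\varphi\in H(t)$; (H4) if $\neg K_a\varphi\in H(s)$ then there is $t$ with $(s,t)\in R_a$ and $\neg\varphi\in H(t)$; (H5) if $(s,t)\in R_a$ then $K_a\varphi\in H(s)$ iff $K_a\varphi\in H(t)$; (H6) if $D\varphi\in H(s)$ and $(s,t)\in R_D$ then $\varphi\in H(t)$; (H7) if $\neg D\varphi\in H(s)$ then there is $t$ with $(s,t)\in R_D$ and $\neg\varphi\in H(t)$; (H8) if $(s,t)\in R_D$ then $D\varphi\in H(s)$ iff $D\varphi\in H(t)$, and $K_a\varphi\in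 H(s)$ iff $K_a\varphi\in H(t)$ for every $a\in\Sigma$; (H9) if $\neg C\varphi\in H(s)$ then there is $t$ with $(s,t)\in R_C$ and $\neg\varphi\in H(t)$. It is a MAEHS for $\theta$ if $\theta\in H(s)$ for some $s\in S$. -}

module Defs where

open import Level using (0ℓ)
open import Data.Product using (Σ; ∃; _×_; _,_)
open import Data.Sum using (_⊎_)
open import Data.Empty using (⊥)
open import Relation.Nullary using (¬_)
open import Relation.Binary.Core using (Rel)
open import Relation.Binary.Structures using (IsEquivalence)
open import Relation.Binary.Construct.Closure.Transitive using (TransClosure)
open import Function.Bundles using (_⇔_)

module _ (AP : Set) (Ag : Set) where

  data Formula : Set where
    atom : AP → Formula
    neg  : Formula → Formula
    and  : Formula → Formula → Formula
    K    : Ag → Formula → Formula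
    D    : Formula → Formula
    C    : Formula → Formula

module _ {AP : Set} {Ag : Set} where

  data _⊑_ : Formula AP Ag → Formula AP Ag → Set where
    ⊑-refl : ∀ {φ} → φ ⊑ φ
    ⊑-neg  : ∀ {ψ φ} → ψ ⊑ φ → ψ ⊑ neg φ
    ⊑-andˡ : ∀ {ψ φ χ} → ψ ⊑ φ → ψ ⊑ and φ χ
    ⊑-andʳ : ∀ {ψ φ χ} → ψ ⊑ χ → ψ ⊑ and φ χ
    ⊑-K    : ∀ {ψ a φ} → ψ ⊑ φ → ψ ⊑ K a φ
    ⊑-D    : ∀ {ψ φ} → ψ ⊑ φ → ψ ⊑ D φ
    ⊑-C    : ∀ {ψ φ} → ψ ⊑ φ → ψ ⊑ C φ

  data IsKD : Formula AP Ag → Set where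
    isK : ∀ a χ → IsKD (K a χ)
    isD : ∀ χ → IsKD (D χ)

record MAES (Ag : Set) : Set₁ where
  field
    S      : Set
    R      : Ag → Rel S 0ℓ
    RD     : Rel S 0ℓ
    RC     : Rel S 0ℓ

  RUnion : Rel S 0ℓ
  RUnion s t = RD s t ⊎ ∃ λ a → R a s t

  field
    RC-closure : ∀ s t → RC s t ⇔ TransClosure RUnion s t

record MAEM (AP : Set) (Ag : Set) : Set₁ where
  field
    structure : MAES Ag
  open MAES structure public
  field
    R-equiv    : ∀ a → IsEquivalence (R a)
    RD-equiv   : IsEquivalence RD
    RD-inter   : ∀ s t → RD s t ⇔ (∀ a → R a s t)
    L          : S → AP → Set

_,_⊨_ : ∀ {AP Ag : Set} (M : MAEM AP Ag) → MAEM.S M → Formula AP Ag → Set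
M , s ⊨ atom p  = MAEM.L M s p
M , s ⊨ neg φ   = ¬ (M , s ⊨ φ)
M , s ⊨ and φ ψ = (M , s ⊨ φ) × (M , s ⊨ ψ)
M , s ⊨ K a φ   = ∀ t → MAEM.R M a s t → M , t ⊨ φ
M , s ⊨ D φ     = ∀ t → MAEM.RD M s t → M , t ⊨ φ
M , s ⊨ C φ     = ∀ t → MAEM.RC M s t → M , t ⊨ φ

SatisfiableMAEM : ∀ {AP Ag : Set} → Formula AP Ag → Set₁
SatisfiableMAEM {AP} {Ag} θ = Σ (MAEM AP Ag) λ M → Σ (MAEM.S M) λ s → M , s ⊨ θ

module _ {AP Ag : Set} where

  FullyExpanded : (Formula AP Ag → Set) → Set
  FullyExpanded Δ =
      (∀ φ → Δ (neg (neg φ)) → Δ φ)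
    × (∀ φ ψ → Δ (and φ ψ) → Δ φ × Δ ψ)
    × (∀ φ ψ → Δ (neg (and φ ψ)) → Δ (neg φ) ⊎ Δ (neg ψ))
    × (∀ a φ → Δ (K a φ) → Δ (D φ))
    × (∀ φ → Δ (D φ) → Δ φ)
    × (∀ φ → Δ (C φ) → ∀ a → Δ (K a (and φ (C φ))))
    × (∀ φ → Δ (neg (C φ)) → ∃ λ a → Δ (neg (K a (and φ (C φ)))))
    × (∀ φ ψ → Δ φ → ψ ⊑ φ → IsKD ψ → Δ ψ ⊎ Δ (neg ψ))

record MAEHS (AP Ag : Set) : Set₁ where
  field
    structure : MAES Ag
  open MAES structure public
  field
    H  : S → Formula AP Ag → Set
    H1 : ∀ s φ → H s (neg φ) → ¬ H s φ
    H2 : ∀ s → FullyExpanded (H s)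
    H3 : ∀ s t a φ → H s (K a φ) → R a s t → H t φ
    H4 : ∀ s a φ → H s (neg (K a φ)) → ∃ λ t → R a s t × H t (neg φ)
    H5 : ∀ s t a φ → R a s t → H s (K a φ) ⇔ H t (K a φ)
    H6 : ∀ s t φ → H s (D φ) → RD s t → H t φ
    H7 : ∀ s φ → H s (neg (D φ)) → ∃ λ t → RD s t × H t (neg φ)
    H8 : ∀ s t → RD s t →
           (∀ φ → H s (D φ) ⇔ H t (D φ)) × (∀ a φ → H s (K a φ) ⇔ H t (K a φ))
    H9 : ∀ s φ → H s (neg (C φ)) → ∃ λ t → RC s t × H t (neg φ)

MAEHSFor : ∀ {AP Ag : Set} → Formula AP Ag → Set₁
MAEHSFor {AP} {Ag} θ = Σ (MAEHS AP Ag) λ 𝓗 → Σ (MAEHS.S 𝓗) λ s → MAEHS.H 𝓗 s θ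

-- Soundness: in a model, the set of formulas true at each state is a Hintikka
-- labelling of the model itself; this uses excluded middle, since Hintikka
-- sets must decide the K/D subformulas and turn ¬∀ into ∃¬.
--
-- Completeness: unravel a Hintikka structure into the tree of finite paths
-- from a state containing θ, each step labelled by an agent a (an R_a-step)
-- or by D (an R_D-step). Agent a cannot distinguish two paths that differ
-- only in a trailing run of a- and D-steps, and D cannot distinguish paths
-- differing in a trailing run of D-steps. These are equivalences by
-- construction; R_D is their intersection because with two distinct agents
-- one of them sees the last agent step. The truth lemma then goes through
-- since (H5) and (H8) make K_a- and D-formulas constant along the steps that
-- a, resp. D, cannot see.
module Submission where

open import Defs
open import Level using (0ℓ)
open import Data.Nat using (ℕ; suc)
open import Data.Fin using (Fin; zero) renaming (suc to fsuc)
open import Function.Bundles using (_⇔_; Equivalence; mk⇔)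
open import Axiom.ExcludedMiddle using (ExcludedMiddle)
open import Axiom.DoubleNegationElimination using (em⇒dne)
open import Data.Empty using (⊥)
import Data.Fin.Properties as Fin
open import Data.List using (List; []; _∷_; dropWhile)
open import Data.List.Relation.Binary.Sublist.Propositional using (_⊆_; ⊆-antisym)
open import Data.List.Relation.Binary.Sublist.Propositional.Properties using (dropWhile-⊆)
open import Data.Product using (Σ; ∃; _×_; _,_; proj₁; proj₂)
open import Data.Sum using (_⊎_; inj₁; inj₂)
open import Data.Unit using (⊤; tt)
open import Function.Base using (_∘_)
open import Function.Construct.Identity using (⇔-id)
open import Function.Construct.Symmetry using (⇔-sym)
open import Function.Construct.Composition using (_⇔-∘_)
open import Relation.Binary.Core using (Rel)
open import Relation.Binary.Definitions using (DecidableEquality)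
open import Relation.Binary.Structures using (IsEquivalence)
open import Relation.Binary.PropositionalEquality
  using (_≡_; _≢_; refl; sym; trans; cong; subst; isEquivalence; ≢-sym; module ≡-Reasoning)
import Relation.Binary.Construct.On as On
open import Relation.Binary.Construct.Closure.Transitive using (TransClosure; [_]; _∷_)
open import Relation.Nullary using (¬_; Dec; yes; no; contradiction)
open import Relation.Nullary.Decidable using (toSum)
open import Relation.Unary using (Pred; Decidable)

module Classical (em : ExcludedMiddle 0ℓ) where

  ¬¬-elim : {P : Set} → ¬ ¬ P → P
  ¬¬-elim = em⇒dne em

  ¬∀⇒∃¬ : {A : Set} {P Q : A → Set} → ¬ (∀ x → P x → Q x) → ∃ λ x → P x × ¬ Q x
  ¬∀⇒∃¬ ¬∀ = ¬¬-elim λ ¬∃ → ¬∀ λ x px → ¬¬-elim λ ¬qx → ¬∃ (x , px , ¬qx)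

  ¬×⇒¬⊎¬ : {P Q : Set} → ¬ (P × Q) → ¬ P ⊎ ¬ Q
  ¬×⇒¬⊎¬ {P} ¬pq with em {P}
  ... | yes p = inj₂ λ q → ¬pq (p , q)
  ... | no ¬p = inj₁ ¬p

module Expanded {AP Ag : Set} {Δ : Formula AP Ag → Set} (fe : FullyExpanded Δ) where

  ¬¬-elim : ∀ {φ} → Δ (neg (neg φ)) → Δ φ
  ¬¬-elim = proj₁ fe _

  ∧-elim : ∀ {φ ψ} → Δ (and φ ψ) → Δ φ × Δ ψ
  ∧-elim = proj₁ (proj₂ fe) _ _

  ¬∧-elim : ∀ {φ ψ} → Δ (neg (and φ ψ)) → Δ (neg φ) ⊎ Δ (neg ψ)
  ¬∧-elim = proj₁ (proj₂ (proj₂ fe)) _ _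

  D-elim : ∀ {φ} → Δ (D φ) → Δ φ
  D-elim = proj₁ (proj₂ (proj₂ (proj₂ (proj₂ fe)))) _

  K-elim : ∀ {a φ} → Δ (K a φ) → Δ φ
  K-elim = D-elim ∘ proj₁ (proj₂ (proj₂ (proj₂ fe))) _ _

  C-unfold : ∀ {φ} → Δ (C φ) → ∀ a → Δ (K a (and φ (C φ)))
  C-unfold = proj₁ (proj₂ (proj₂ (proj₂ (proj₂ (proj₂ fe))))) _

  C-elim : ∀ {φ} → Ag → Δ (C φ) → Δ φ
  C-elim a c = proj₁ (∧-elim (K-elim (C-unfold c a)))

module Soundness (em : ExcludedMiddle 0ℓ) {AP Ag : Set} (a₀ : Ag) (M : MAEM AP Ag) where
  open MAEM M
  open Classical em

  RD⊆R : ∀ a {s t} → RD s t → R a s t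
  RD⊆R a r = Equivalence.to (RD-inter _ _) r a

  toRC : ∀ {s t} → TransClosure RUnion s t → RC s t
  toRC = Equivalence.from (RC-closure _ _)

  fromRC : ∀ {s t} → RC s t → TransClosure RUnion s t
  fromRC = Equivalence.to (RC-closure _ _)

  necessity-invariant : {ρ : Rel S 0ℓ} → IsEquivalence ρ → ∀ {P : S → Set} {s t} → ρ s t →
                        (∀ u → ρ s u → P u) ⇔ (∀ u → ρ t u → P u)
  necessity-invariant ρ-equiv r =
    mk⇔ (λ □P u r′ → □P u (ρ.trans r r′)) (λ □P u r′ → □P u (ρ.trans (ρ.sym r) r′))
    where module ρ = IsEquivalence ρ-equiv

  K-invariant : ∀ {a φ s t} → R a s t → (M , s ⊨ K a φ) ⇔ (M , t ⊨ K a φ)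
  K-invariant {a} = necessity-invariant (R-equiv a)

  D-invariant : ∀ {φ s t} → RD s t → (M , s ⊨ D φ) ⇔ (M , t ⊨ D φ)
  D-invariant = necessity-invariant RD-equiv

  C-unfold : ∀ {φ s} → M , s ⊨ C φ → ∀ a → M , s ⊨ K a (and φ (C φ))
  C-unfold c a t r = c t (toRC [ inj₂ (a , r) ]) , λ u r′ → c u (toRC (inj₂ (a , r) ∷ fromRC r′))

  -- Every R_C-path starts with an R_a-step for some a, since R_D ⊆ R_{a₀}.
  C-fold : ∀ {φ s} → (∀ a → M , s ⊨ K a (and φ (C φ))) → M , s ⊨ C φ
  C-fold {φ} {s} k t r = along (fromRC r)
    where
    first-step : ∀ {u} → RUnion s u → ∃ λ a → R a s u
    first-step (inj₁ r) = a₀ , RD⊆R a₀ r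
    first-step (inj₂ ar) = ar

    along : ∀ {u} → TransClosure RUnion s u → M , u ⊨ φ
    along [ r ] with first-step r
    ... | a , r′ = proj₁ (k a _ r′)
    along (r ∷ rs) with first-step r
    ... | a , r′ = proj₂ (k a _ r′) _ (toRC rs)

  Truths : S → Formula AP Ag → Set
  Truths s φ = M , s ⊨ φ

  truths-fullyExpanded : ∀ s → FullyExpanded (Truths s)
  truths-fullyExpanded s =
      (λ _ → ¬¬-elim)
    , (λ _ _ φψ → φψ)
    , (λ _ _ → ¬×⇒¬⊎¬)
    , (λ a _ k t r → k t (RD⊆R a r))
    , (λ _ d → d s (IsEquivalence.refl RD-equiv))
    , (λ φ → C-unfold {φ})
    , (λ φ ¬c → ¬¬-elim λ ¬∃ → ¬c (C-fold {φ} λ a → ¬¬-elim λ ¬k → ¬∃ (a , ¬k)))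
    , (λ _ ψ _ _ _ → toSum (em {Truths s ψ}))

  hintikka : MAEHS AP Ag
  hintikka = record
    { structure = structure
    ; H  = Truths
    ; H1 = λ _ _ ¬φ φ → ¬φ φ
    ; H2 = truths-fullyExpanded
    ; H3 = λ _ t _ _ k r → k t r
    ; H4 = λ _ _ _ → ¬∀⇒∃¬
    ; H5 = λ _ _ _ φ → K-invariant {φ = φ}
    ; H6 = λ _ t _ d r → d t r
    ; H7 = λ _ _ → ¬∀⇒∃¬
    ; H8 = λ _ _ r → (λ φ → D-invariant {φ} r) , (λ a φ → K-invariant {φ = φ} (RD⊆R a r))
    ; H9 = λ _ _ → ¬∀⇒∃¬
    }

module _ {A : Set} {P : Pred A 0ℓ} (P? : Decidable P) where

  dropWhile-dropped : ∀ {x xs} → P x → dropWhile P? (x ∷ xs) ≡ dropWhile P? xs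
  dropWhile-dropped {x} px with P? x
  ... | yes _ = refl
  ... | no ¬px = contradiction px ¬px

  dropWhile-kept : ∀ {x xs} → ¬ P x → dropWhile P? (x ∷ xs) ≡ x ∷ xs
  dropWhile-kept {x} ¬px with P? x
  ... | yes px = contradiction px ¬px
  ... | no _ = refl

  dropWhile-absorbs : {Q : Pred A 0ℓ} (Q? : Decidable Q) → (∀ {x} → Q x → P x) →
                      ∀ xs → dropWhile P? (dropWhile Q? xs) ≡ dropWhile P? xs
  dropWhile-absorbs Q? Q⊆P [] = refl
  dropWhile-absorbs Q? Q⊆P (x ∷ xs) with Q? x
  ... | yes qx = trans (dropWhile-absorbs Q? Q⊆P xs) (sym (dropWhile-dropped (Q⊆P qx)))
  ... | no _ = refl

data Label (Ag : Set) : Set where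
  agent : Ag → Label Ag
  dist  : Label Ag

module Unravelling {AP Ag : Set} (_≟_ : DecidableEquality Ag)
                   (a₀ a₁ : Ag) (a₀≢a₁ : a₀ ≢ a₁)
                   (𝓗 : MAEHS AP Ag) (s₀ : MAEHS.S 𝓗) where
  open MAEHS 𝓗

  -- the most recent step comes first
  Trace : Set
  Trace = List (Label Ag × S)

  end : Trace → S
  end [] = s₀
  end ((_ , t) ∷ _) = t

  Edge : Label Ag → Rel S 0ℓ
  Edge (agent a) = R a
  Edge dist      = RD

  IsPath : Trace → Set
  IsPath [] = ⊤
  IsPath ((ℓ , t) ∷ u) = Edge ℓ (end u) t × IsPath u

  Node : Set
  Node = Σ Trace IsPath

  root : Node
  root = [] , tt

  tip : Node → S
  tip = end ∘ proj₁

  Invisible : Ag → Label Ag → Set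
  Invisible a (agent b) = a ≡ b
  Invisible a dist      = ⊤

  invisible? : ∀ a ℓ → Dec (Invisible a ℓ)
  invisible? a (agent b) = a ≟ b
  invisible? a dist      = yes tt

  IsDist : Label Ag → Set
  IsDist (agent _) = ⊥
  IsDist dist      = ⊤

  isDist? : ∀ ℓ → Dec (IsDist ℓ)
  isDist? (agent _) = no λ ()
  isDist? dist      = yes tt

  dist-invisible : ∀ {a} ℓ → IsDist ℓ → Invisible a ℓ
  dist-invisible dist _ = tt

  dropSteps : {P : Label Ag → Set} → (∀ ℓ → Dec (P ℓ)) → Trace → Trace
  dropSteps P? = dropWhile (P? ∘ proj₁)

  view : Ag → Trace → Trace
  view a = dropSteps (invisible? a)

  viewD : Trace → Trace
  viewD = dropSteps isDist?

  view-viewD : ∀ a u → view a (viewD u) ≡ view a u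
  view-viewD a = dropWhile-absorbs (invisible? a ∘ proj₁) (isDist? ∘ proj₁) λ {(ℓ , _)} → dist-invisible ℓ

  someone-sees-viewD : ∀ u → ∃ λ a → view a (viewD u) ≡ viewD u
  someone-sees-viewD [] = a₀ , refl
  someone-sees-viewD ((dist , _) ∷ u) = someone-sees-viewD u
  someone-sees-viewD ((agent b , _) ∷ u) with a₀ ≟ b
  ... | no a₀≢b  = a₀ , dropWhile-kept (invisible? a₀ ∘ proj₁) a₀≢b
  ... | yes refl = a₁ , dropWhile-kept (invisible? a₁ ∘ proj₁) (≢-sym a₀≢a₁)

  viewD-⊆ : ∀ u v → (∀ a → view a u ≡ view a v) → viewD u ⊆ viewD v
  viewD-⊆ u v same with someone-sees-viewD u
  ... | a , sees = subst (_⊆ viewD v) viewD-u≡ (dropWhile-⊆ (invisible? a ∘ proj₁) (viewD v))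
    where
    open ≡-Reasoning
    viewD-u≡ : view a (viewD v) ≡ viewD u
    viewD-u≡ = begin
      view a (viewD v)  ≡⟨ view-viewD a v ⟩
      view a v          ≡⟨ same a ⟨
      view a u          ≡⟨ view-viewD a u ⟨
      view a (viewD u)  ≡⟨ sees ⟩
      viewD u           ∎

  SameView : (Trace → Trace) → Rel Node 0ℓ
  SameView f x y = f (proj₁ x) ≡ f (proj₁ y)

  Step : Rel Node 0ℓ
  Step x y = SameView viewD x y ⊎ ∃ λ a → SameView (view a) x y

  RD-inter : ∀ x y → SameView viewD x y ⇔ (∀ a → SameView (view a) x y)
  RD-inter (u , _) (v , _) = mk⇔
    (λ same a → trans (sym (view-viewD a u)) (trans (cong (view a) same) (view-viewD a v)))
    (λ same → ⊆-antisym (viewD-⊆ u v same) (viewD-⊆ v u (sym ∘ same)))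

  model : MAEM AP Ag
  model = record
    { structure = record
      { S = Node ; R = SameView ∘ view ; RD = SameView viewD ; RC = TransClosure Step
      ; RC-closure = λ _ _ → ⇔-id _ }
    ; R-equiv  = λ a → On.isEquivalence (view a ∘ proj₁) isEquivalence
    ; RD-equiv = On.isEquivalence (viewD ∘ proj₁) isEquivalence
    ; RD-inter = RD-inter
    ; L = λ x p → H (tip x) (atom p)
    }

  extend : ∀ x ℓ t → Edge ℓ (tip x) t → Node
  extend (u , p) ℓ t e = (ℓ , t) ∷ u , e , p

  agent-step : ∀ x {a t} (r : R a (tip x) t) → SameView (view a) x (extend x (agent a) t r)
  agent-step x {a} _ = sym (dropWhile-dropped (invisible? a ∘ proj₁) refl)

  union-step : ∀ x {t} → RUnion (tip x) t → Σ Node λ y → Step x y × tip y ≡ t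
  union-step x (inj₁ r)       = extend x dist _ r , inj₁ refl , refl
  union-step x (inj₂ (a , r)) = extend x (agent a) _ r , inj₂ (a , agent-step x r) , refl

  union-path : ∀ x {t} → TransClosure RUnion (tip x) t → Σ Node λ y → TransClosure Step x y × tip y ≡ t
  union-path x [ r ] with union-step x r
  ... | y , s , e = y , [ s ] , e
  union-path x (r ∷ rs) with union-step x r
  ... | y , s , refl with union-path y rs
  ... | z , ss , e = z , s ∷ ss , e

  end-invariant : {P : Label Ag → Set} (P? : ∀ ℓ → Dec (P ℓ)) (Q : S → Set) →
                  (∀ {ℓ s t} → P ℓ → Edge ℓ s t → Q s ⇔ Q t) →
                  ∀ u → IsPath u → Q (end u) ⇔ Q (end (dropSteps P? u))
  end-invariant P? Q steady [] _ = ⇔-id _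
  end-invariant P? Q steady ((ℓ , t) ∷ u) (e , p) with P? ℓ
  ... | yes pℓ = end-invariant P? Q steady u p ⇔-∘ ⇔-sym (steady pℓ e)
  ... | no _   = ⇔-id _

  transfer : {P : Label Ag → Set} (P? : ∀ ℓ → Dec (P ℓ)) (Q : S → Set) →
             (∀ {ℓ s t} → P ℓ → Edge ℓ s t → Q s ⇔ Q t) →
             ∀ x y → SameView (dropSteps P?) x y → Q (tip x) → Q (tip y)
  transfer P? Q steady (u , p) (v , q) same =
    Equivalence.from (end-invariant P? Q steady v q) ∘ subst (Q ∘ end) same ∘
    Equivalence.to (end-invariant P? Q steady u p)

  K-steady : ∀ {a φ ℓ s t} → Invisible a ℓ → Edge ℓ s t → H s (K a φ) ⇔ H t (K a φ)
  K-steady {ℓ = agent _} refl e = H5 _ _ _ _ e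
  K-steady {ℓ = dist}    _    e = proj₂ (H8 _ _ e) _ _

  D-steady : ∀ {φ ℓ s t} → IsDist ℓ → Edge ℓ s t → H s (D φ) ⇔ H t (D φ)
  D-steady {ℓ = dist} _ e = proj₁ (H8 _ _ e) _

  K-transfer : ∀ {a φ} x y → SameView (view a) x y → H (tip x) (K a φ) → H (tip y) (K a φ)
  K-transfer {a} {φ} = transfer (invisible? a) (λ s → H s (K a φ)) K-steady

  D-transfer : ∀ {φ} x y → SameView viewD x y → H (tip x) (D φ) → H (tip y) (D φ)
  D-transfer {φ} = transfer isDist? (λ s → H s (D φ)) D-steady

  private module H-expanded {s : S} = Expanded (H2 s)
  open H-expanded

  C-transfer-view : ∀ {a φ} x y → SameView (view a) x y → H (tip x) (C φ) → H (tip y) (C φ)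
  C-transfer-view {a} x y same c = proj₂ (∧-elim (K-elim (K-transfer x y same (C-unfold c a))))

  C-transfer-step : ∀ {φ} x y → Step x y → H (tip x) (C φ) → H (tip y) (C φ)
  C-transfer-step x y (inj₁ same)       = C-transfer-view x y (Equivalence.to (RD-inter x y) same a₀)
  C-transfer-step x y (inj₂ (_ , same)) = C-transfer-view x y same

  C-transfer : ∀ {φ x y} → TransClosure Step x y → H (tip x) (C φ) → H (tip y) (C φ)
  C-transfer {x = x} {y} [ s ]            = C-transfer-step x y s
  C-transfer {x = x} (_∷_ {y = z} s ss) = C-transfer ss ∘ C-transfer-step x z s

  truth⁺ : ∀ φ x → H (tip x) φ → model , x ⊨ φ
  truth⁻ : ∀ φ x → H (tip x) (neg φ) → ¬ (model , x ⊨ φ)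

  truth⁺ (atom p)  x h        = h
  truth⁺ (neg φ)   x h        = truth⁻ φ x h
  truth⁺ (and φ ψ) x h        = truth⁺ φ x (proj₁ (∧-elim h)) , truth⁺ ψ x (proj₂ (∧-elim h))
  truth⁺ (K a φ)   x h y same = truth⁺ φ y (K-elim (K-transfer x y same h))
  truth⁺ (D φ)     x h y same = truth⁺ φ y (D-elim (D-transfer x y same h))
  truth⁺ (C φ)     x h y path = truth⁺ φ y (C-elim a₀ (C-transfer path h))

  truth⁻ (atom p)  x h = H1 _ _ h
  truth⁻ (neg φ)   x h = λ ⊭φ → ⊭φ (truth⁺ φ x (¬¬-elim h))
  truth⁻ (and φ ψ) x h (⊨φ , ⊨ψ) with ¬∧-elim h
  ... | inj₁ ¬φ = truth⁻ φ x ¬φ ⊨φ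
  ... | inj₂ ¬ψ = truth⁻ ψ x ¬ψ ⊨ψ
  truth⁻ (K a φ) x h ⊨K with H4 _ a φ h
  ... | t , r , ¬φ = truth⁻ φ (extend x (agent a) t r) ¬φ (⊨K _ (agent-step x r))
  truth⁻ (D φ) x h ⊨D with H7 _ φ h
  ... | t , r , ¬φ = truth⁻ φ (extend x dist t r) ¬φ (⊨D _ refl)
  truth⁻ (C φ) x h ⊨C with H9 _ φ h
  ... | t , r , ¬φ with union-path x (Equivalence.to (RC-closure _ _) r)
  ... | y , path , refl = truth⁻ φ y ¬φ (⊨C y path)

theorem1 : ExcludedMiddle 0ℓ →
    (AP : Set) → AP → (n : ℕ) →
    (θ : Formula AP (Fin (suc (suc n)))) →
    SatisfiableMAEM θ ⇔ MAEHSFor θ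
theorem1 em AP _ n θ = mk⇔ sound complete
  where
  sound : SatisfiableMAEM θ → MAEHSFor θ
  sound (M , s , ⊨θ) = Soundness.hintikka em zero M , s , ⊨θ

  complete : MAEHSFor θ → SatisfiableMAEM θ
  complete (𝓗 , s , θ∈H) = model , root , truth⁺ θ root θ∈H
    where open Unravelling Fin._≟_ zero (fsuc zero) (λ ()) 𝓗 s
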